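{- Let $I$ be a finite set and let $C$ be a finite set of partially defined real-valued functions on $I$, each $c\in C$ having a nonempty domain $\mathrm{Dom}(c)\subseteq I$, such that for every $i\in I$ the set $C$ contains a function with domain $\{i\}$. Then there exists a compromise function $x:I\to\mathbb R$ for $C$, i.e. a function such that (1) for every $c\in C$ there is $i\in\mathrm{Dom}(c)$ with $c(i)\le x(i)$, and (2) for every $i\in I$ there is $c\in C$ with $i\in\mathrm{Dom}(c)$ and $x(j)\le c(j)$ for all $j\in\mathrm{Dom}(c)$. -}

module Defs where

open import Level using (Level)
open import Data.Nat using (ℕ)
open import Data.Fin using (Fin)
open import Data.Fin.Subset using (Subset; _∈_; Nonempty; ⁅_⁆)
open import Data.Product using (Σ; ∃; _×_)
open import Relation.Binary.Bundles using (TotalOrder)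
open import Relation.Binary.PropositionalEquality using (_≡_)

-- Everything is parametrised by a totally ordered value set V
-- (the paper uses V = ℝ with its usual order).
module _ {a ℓ₁ ℓ₂ : Level} (V : TotalOrder a ℓ₁ ℓ₂) where
  open TotalOrder V renaming (Carrier to A)

  record PFun (n : ℕ) : Set a where
    field
      dom : Subset n
      val : (i : Fin n) → i ∈ dom → A
  open PFun public

  IsCompromise : {n m : ℕ} → (Fin m → PFun n) → (Fin n → A) → Set ℓ₂
  IsCompromise {n} {m} C x =
    ((k : Fin m) → ∃ λ (i : Fin n) → Σ (i ∈ dom (C k)) λ p → val (C k) i p ≤ x i)
    ×
    ((i : Fin n) → ∃ λ (k : Fin m) → (i ∈ dom (C k)) ×
        ((j : Fin n) (p : j ∈ dom (C k)) → x j ≤ val (C k) j p))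

{-# OPTIONS --safe #-}
module Submission where

-- Start from an x large enough that every c is met somewhere (c(i) ≤ x(i)), and then
-- treat the points of I one at a time.  At i, call c pinned to i if i is the only
-- point of Dom(c) where c is met.  Lowering x(i) to the largest value c(i) among the
-- pinned c keeps every c met, and the pinned c attaining that value now witnesses
-- condition (2) at i.  The singleton function at i is always pinned to i, so that
-- maximum exists.  Since x only decreases, condition (2) survives at the points
-- already treated.

open import Defs
open import Level using (Level)
open import Data.Nat using (ℕ; zero; suc)
open import Data.Fin using (Fin; zero; suc; _≟_)
open import Data.Fin.Subset using (Subset; Nonempty; ⁅_⁆) renaming (_∈_ to _∈ₛ_)
open import Data.Fin.Subset.Properties using (_∈?_; x∈⁅x⁆; x∈⁅y⁆⇒x≡y)
open import Data.Product using (∃; Σ; _×_; _,_; proj₁; proj₂)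
open import Data.Sum using (_⊎_; inj₁; inj₂; swap)
open import Data.List using (List; []; _∷_; allFin)
open import Data.List.Relation.Unary.All as All using (All; []; _∷_)
open import Data.List.Membership.Propositional.Properties using (∈-allFin)
open import Data.Vec.Functional using (updateAt)
open import Data.Vec.Functional.Properties using (updateAt-updates; updateAt-minimal)
open import Data.Vec.Properties.WithK using ([]=-irrelevant)
open import Function using (const)
open import Relation.Nullary using (¬_; yes; no; contradiction)
open import Relation.Nullary.Decidable using (toSum)
open import Relation.Binary.Bundles using (TotalOrder)
open import Relation.Binary.PropositionalEquality
  using (_≡_; _≢_; refl; sym; cong; subst)

∃⊎∀ : ∀ {ℓ M} {Q R : Fin M → Set ℓ} → (∀ k → Q k ⊎ R k) → ∃ Q ⊎ (∀ k → R k)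
∃⊎∀ {M = zero}  split = inj₂ λ ()
∃⊎∀ {M = suc M} split with split zero | ∃⊎∀ (λ k → split (suc k))
... | inj₁ q | _              = inj₁ (zero , q)
... | inj₂ r | inj₁ (k , q)   = inj₁ (suc k , q)
... | inj₂ r | inj₂ rs        = inj₂ λ { zero → r ; (suc k) → rs k }

updateAt-elim : ∀ {a ℓ n} {A : Set a} (P : Fin n → A → Set ℓ) (xs : Fin n → A) i {f : A → A} →
                P i (f (xs i)) → (∀ j → j ≢ i → P j (xs j)) → ∀ j → P j (updateAt xs i f j)
updateAt-elim P xs i at-i elsewhere j with j ≟ i
... | yes refl = subst (P i) (sym (updateAt-updates i xs)) at-i
... | no j≢i   = subst (P j) (sym (updateAt-minimal j i xs j≢i)) (elsewhere j j≢i)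

module _ {a ℓ₁ ℓ₂ : Level} (V : TotalOrder a ℓ₁ ℓ₂) where
  open TotalOrder V using (_≤_; total; trans) renaming (Carrier to A; refl to ≤-refl)

  all⊎maximum : ∀ {ℓ M} {P Q : Fin M → Set ℓ} (g : ∀ k → Q k → A) → (∀ k → P k ⊎ Q k) →
                (∀ k → P k) ⊎
                (∃ λ k → Σ (Q k) λ q → ∀ l → P l ⊎ Σ (Q l) λ r → g l r ≤ g k q)
  all⊎maximum {M = zero}  g split = inj₁ λ ()
  all⊎maximum {M = suc M} {P} {Q} g split
    with split zero | all⊎maximum (λ k → g (suc k)) (λ k → split (suc k))
  ... | inj₁ p | inj₁ ps = inj₁ λ { zero → p ; (suc l) → ps l }
  ... | inj₁ p | inj₂ (k , q , max) = inj₂ (suc k , q , λ { zero → inj₁ p ; (suc l) → max l })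
  ... | inj₂ q | inj₁ ps = inj₂ (zero , q , λ { zero → inj₂ (q , ≤-refl) ; (suc l) → inj₁ (ps l) })
  ... | inj₂ q₀ | inj₂ (k , q , max) with total (g zero q₀) (g (suc k) q)
  ...   | inj₁ q₀≤q = inj₂ (suc k , q , λ { zero → inj₂ (q₀ , q₀≤q) ; (suc l) → max l })
  ...   | inj₂ q≤q₀ = inj₂ (zero , q₀ , λ { zero → inj₂ (q₀ , ≤-refl) ; (suc l) → below l })
    where
      below : ∀ l → P (suc l) ⊎ Σ (Q (suc l)) λ r → g (suc l) r ≤ g zero q₀
      below l with max l
      ... | inj₁ p       = inj₁ p
      ... | inj₂ (r , le) = inj₂ (r , trans le q≤q₀)

  module Compromise {n m : ℕ} (C : Fin m → PFun V n) where
    Dom : Fin m → Subset n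
    Dom k = dom (C k)

    c : (k : Fin m) (j : Fin n) → j ∈ₛ Dom k → A
    c k = val (C k)

    c-irrelevant : ∀ {k j} (p q : j ∈ₛ Dom k) → c k j p ≡ c k j q
    c-irrelevant {k} {j} p q = cong (c k j) ([]=-irrelevant p q)

    Met : (Fin n → A) → Fin m → Set ℓ₂
    Met x k = ∃ λ i → Σ (i ∈ₛ Dom k) λ p → c k i p ≤ x i

    Supported : (Fin n → A) → Fin n → Set ℓ₂
    Supported x i = ∃ λ k → (i ∈ₛ Dom k) × (∀ j (p : j ∈ₛ Dom k) → x j ≤ c k j p)

    Supported-antimono : ∀ {x y} → (∀ j → y j ≤ x j) → ∀ {i} → Supported x i → Supported y i
    Supported-antimono y≤x (k , i∈ , x≤c) = k , i∈ , λ j p → trans (y≤x j) (x≤c j p)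

    MetAway : (Fin n → A) → Fin n → Fin m → Set ℓ₂
    MetAway x i k = ∃ λ j → Σ (j ∈ₛ Dom k) λ p → j ≢ i × c k j p ≤ x j

    PinnedTo : (Fin n → A) → Fin n → Fin m → Set ℓ₂
    PinnedTo x i k = Σ (i ∈ₛ Dom k) λ p → c k i p ≤ x i ×
                     (∀ j (q : j ∈ₛ Dom k) → j ≢ i → x j ≤ c k j q)

    metAway⊎pinnedTo : ∀ {x} i {k} → Met x k → MetAway x i k ⊎ PinnedTo x i k
    metAway⊎pinnedTo {x} i {k} (j , p , c≤x) with j ≟ i
    ... | no j≢i   = inj₁ (j , p , j≢i , c≤x)
    ... | yes refl with ∃⊎∀ compare
      where
        compare : ∀ l → (Σ (l ∈ₛ Dom k) λ q → l ≢ i × c k l q ≤ x l) ⊎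
                        (∀ (q : l ∈ₛ Dom k) → l ≢ i → x l ≤ c k l q)
        compare l with l ∈? Dom k | l ≟ i
        ... | no l∉  | _        = inj₂ λ l∈ _ → contradiction l∈ l∉
        ... | yes _  | yes l≡i  = inj₂ λ _ l≢i → contradiction l≡i l≢i
        ... | yes q  | no l≢i with total (c k l q) (x l)
        ...   | inj₁ c≤x = inj₁ (q , l≢i , c≤x)
        ...   | inj₂ x≤c = inj₂ λ q′ _ → subst (x l ≤_) (c-irrelevant q q′) x≤c
    ...   | inj₁ (l , away) = inj₁ (l , away)
    ...   | inj₂ above      = inj₂ (p , c≤x , above)

    singleton-not-metAway : ∀ {x i k} → Dom k ≡ ⁅ i ⁆ → ¬ MetAway x i k
    singleton-not-metAway {i = i} dom≡ (j , p , j≢i , _) =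
      contradiction (x∈⁅y⁆⇒x≡y i (subst (j ∈ₛ_) dom≡ p)) j≢i

    Singletons : Set
    Singletons = ∀ i → ∃ λ s → Dom s ≡ ⁅ i ⁆

    ∈-singleton : ∀ {i s} → Dom s ≡ ⁅ i ⁆ → i ∈ₛ Dom s
    ∈-singleton {i} dom≡ = subst (i ∈ₛ_) (sym dom≡) (x∈⁅x⁆ i)

    upperBound : Singletons → ∀ j → ∃ λ y → ∀ k (p : j ∈ₛ Dom k) → c k j p ≤ y
    upperBound singletons j with all⊎maximum (λ k p → c k j p) (λ k → swap (toSum (j ∈? Dom k)))
    ... | inj₁ nowhere = contradiction (∈-singleton (proj₂ (singletons j))) (nowhere _)
    ... | inj₂ (k , q , max) = c k j q , bound
      where
        bound : ∀ l (p : j ∈ₛ Dom l) → c l j p ≤ c k j q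
        bound l p with max l
        ... | inj₁ ¬p       = contradiction p ¬p
        ... | inj₂ (r , le) = subst (_≤ c k j q) (c-irrelevant r p) le

    start : Singletons → (∀ k → Nonempty (Dom k)) → ∃ λ x → ∀ k → Met x k
    start singletons nonempty = x₀ , met
      where
        x₀ : Fin n → A
        x₀ j = proj₁ (upperBound singletons j)

        met : ∀ k → Met x₀ k
        met k with nonempty k
        ... | i , p = i , p , proj₂ (upperBound singletons i) k p

    lower : ∀ {x} → (∀ k → Met x k) → ∀ i → (∃ λ s → Dom s ≡ ⁅ i ⁆) →
            ∃ λ x′ → (∀ j → x′ j ≤ x j) × (∀ k → Met x′ k) × Supported x′ i
    lower {x} met i (s , Dom-s) with all⊎maximum value (λ k → metAway⊎pinnedTo i (met k))
      where
        value : ∀ k → PinnedTo x i k → A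
        value k (p , _) = c k i p
    ... | inj₁ allAway = contradiction (allAway s) (singleton-not-metAway Dom-s)
    ... | inj₂ (k , (i∈ , c≤x , x≤c) , max) = x′ , x′≤x , met′ , k , i∈ , x′≤c
      where
        t : A
        t = c k i i∈

        x′ : Fin n → A
        x′ = updateAt x i (const t)

        x′≤x : ∀ j → x′ j ≤ x j
        x′≤x = updateAt-elim (λ j y → y ≤ x j) x i c≤x (λ j _ → ≤-refl)

        met′ : ∀ l → Met x′ l
        met′ l with max l
        ... | inj₁ (j , p , j≢i , le) =
          j , p , subst (c l j p ≤_) (sym (updateAt-minimal j i x j≢i)) le
        ... | inj₂ ((p , _) , le) =
          i , p , subst (c l i p ≤_) (sym (updateAt-updates i x)) le

        x′≤c : ∀ j (p : j ∈ₛ Dom k) → x′ j ≤ c k j p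
        x′≤c = updateAt-elim (λ j y → ∀ p → y ≤ c k j p) x i
                 (λ p → subst (t ≤_) (c-irrelevant i∈ p) ≤-refl)
                 (λ j j≢i p → x≤c j p j≢i)

    lowerAll : Singletons → ∀ {x} → (∀ k → Met x k) → (is : List (Fin n)) →
               ∃ λ x′ → (∀ k → Met x′ k) × All (Supported x′) is
    lowerAll singletons met []       = _ , met , []
    lowerAll singletons met (i ∷ is) with lowerAll singletons met is
    ... | x₁ , met₁ , sup₁ with lower met₁ i (singletons i)
    ...   | x₂ , x₂≤x₁ , met₂ , sup₂ = x₂ , met₂ , sup₂ ∷ All.map (Supported-antimono x₂≤x₁) sup₁

theoremB1 : {a ℓ₁ ℓ₂ : Level} (V : TotalOrder a ℓ₁ ℓ₂) (n m : ℕ) (C : Fin m → PFun V n)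
            → ((k : Fin m) → Nonempty (PFun.dom (C k)))
            → ((i : Fin n) → ∃ λ (k : Fin m) → PFun.dom (C k) ≡ ⁅ i ⁆)
            → ∃ λ (x : Fin n → TotalOrder.Carrier V) → IsCompromise V C x
theoremB1 V n m C nonempty singletons
  with lowerAll singletons (proj₂ (start singletons nonempty)) (allFin n)
  where open Compromise V C
... | x , met , supported = x , met , λ i → All.lookup supported (∈-allFin i)
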